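{- Let $Q$, $\mathcal{O}$, $L$ be as in the context, and let $\gamma_1,\gamma_2$ be maximal chains of $L$ (saturated chains from $\hat0=\mathrm{srce}(Q)$ to $\hat1=\mathrm{sink}(Q)$). Suppose there exist $x<_L x'$ with $x,x'\in\gamma_1\cap\gamma_2$ such that $x$ is covered by distinct elements in $\gamma_1$ and in $\gamma_2$. Then the path $\gamma_1*\gamma_2$ (for any choices made in its construction) keeps the segment $\gamma_1|_{[x',\hat1]}$ fixed until after it has transformed $\gamma_1|_{[\hat0,x']}$ into $\gamma_2|_{[\hat0,x']}$.
   Context: $Q$ is a polytope, $\mathcal{O}$ a facial orientation of its 1-skeleton (acyclic, each face $F$ has a unique source $\mathrm{srce}(F)$ and sink $\mathrm{sink}(F)$), $Q$ is $\mathcal{O}$-directionally simple (for each vertex $x$ and each subset $E$ of edges directed out of $x$ there is a distinct $|E|$-face containing $x$ and $E$), and $\mathcal{O}$ is the Hasse diagram of a lattice $L$ on the vertices of $Q$. A move across a 2-face $F$ replaces a segment of a chain running along one directed boundary path of $F$ from $\mathrm{srce}(F)$ to $\mathrm{sink}(F)$ by the other boundary path. For saturated chains $\gamma_1,\gamma_2$ from $u$ to $v$, the sequence of moves $\gamma_1*\gamma_2$ is defined recursively: if $\gamma_1=\gamma_2$ it is trivial. Otherwise let $x$ be the lowest element of $\gamma_1\cap\gamma_2$ covered by distinct elements $a_1\in\gamma_1$, $a_2\in\gamma_2$, and $x'$ the next element of $\gamma_1\cap\gamma_2$ above $x$. Let $F$ be the unique 2-face containing the edges $xa_1$ and $xa_2$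 (then $\mathrm{sink}(F)=a_1\vee a_2\le x'$). Choose a saturated chain $p$ from $\mathrm{sink}(F)$ to $v$ through $x'$, agreeing with $\gamma_1$ on $[x',v]$, and agreeing with $\gamma_1$ on $[\mathrm{sink}(F),v]$ if $\mathrm{sink}(F)\in\gamma_1$. Let $\gamma_i^F$ ($i=1,2$) follow $\gamma_i$ from $u$ to $a_i$, then the boundary path of $F$ from $a_i$ to $\mathrm{sink}(F)$, then $p$. Then $\gamma_1*\gamma_2$ consists of the moves of $\gamma_1*\gamma_1^F$, then the move across $F$ from $\gamma_1^F$ to $\gamma_2^F$, then the moves of $\gamma_2^F*\gamma_2$; it is regarded as a path in the move graph from $\gamma_1$ to $\gamma_2$. -}

module Defs where

open import Level using (Level; _⊔_) renaming (suc to lsuc; zero to lzero)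
open import Data.Nat using (ℕ; zero; suc)
open import Data.Fin using (Fin)
open import Data.List using (List; []; _∷_; _++_; length)
open import Data.List.Membership.Propositional using (_∈_)
open import Data.List.Relation.Unary.All using (All)
open import Data.List.Relation.Unary.Unique.Propositional using (Unique)
open import Data.Product using (Σ; ∃; ∃-syntax; _×_; _,_)
open import Data.Sum using (_⊎_)
open import Relation.Nullary using (¬_)
open import Relation.Binary.PropositionalEquality using (_≡_; _≢_)
open import Relation.Binary.Construct.Closure.Transitive using (TransClosure)
open import Relation.Binary.Structures using (IsTotalOrder)
open import Relation.Binary.Lattice.Structures using (IsLattice)
open import Algebra.Structures using (IsCommutativeRing)

record OrderedField : Set₁ where
  infixl 6 _+_
  infixl 7 _*_
  infix 4 _≤_
  field
    Carrier : Set
    _+_ _*_ : Carrier → Carrier → Carrier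
    -_      : Carrier → Carrier
    0# 1#   : Carrier
    _≤_     : Carrier → Carrier → Set
    isCommutativeRing : IsCommutativeRing _≡_ _+_ _*_ -_ 0# 1#
    0≢1     : 0# ≢ 1#
    inverse : ∀ x → x ≢ 0# → ∃[ y ] (x * y ≡ 1#)
    isTotalOrder : IsTotalOrder _≡_ _≤_
    +-mono  : ∀ {x y} z → x ≤ y → x + z ≤ y + z
    *-pos   : ∀ {x y} → 0# ≤ x → 0# ≤ y → 0# ≤ x * y

-- A polytope Q ⊆ K^d is given by its vertex list
-- v : Fin n → K^d  (Q = conv of the v i, and each v i is a vertex).
-- Faces are represented by their vertex sets (predicates on Fin n).

module Geometry (K : OrderedField) {d n : ℕ} (v : Fin n → Fin d → OrderedField.Carrier K) where
  open OrderedField K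

  Σ[_] : ∀ {m} → (Fin m → Carrier) → Carrier
  Σ[_] {zero}  f = 0#
  Σ[_] {suc m} f = f Fin.zero + Σ[ (λ i → f (Fin.suc i)) ]

  dot : (Fin d → Carrier) → (Fin d → Carrier) → Carrier
  dot c w = Σ[ (λ k → c k * w k) ]

  VSet : Set₁
  VSet = Fin n → Set

  -- F is (the vertex set of) a nonempty face of Q: the set of vertices
  -- maximising some linear functional c (c = 0 gives Q itself).
  IsFace : VSet → Set
  IsFace F = ∃[ c ] (∀ i → (F i → ∀ j → dot c (v j) ≤ dot c (v i))
                          × ((∀ j → dot c (v j) ≤ dot c (v i)) → F i))

  AffIndep : ∀ {m} → (Fin (suc m) → Fin n) → Set
  AffIndep {m} w = ∀ (λs : Fin (suc m) → Carrier) → Σ[ λs ] ≡ 0#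
    → (∀ k → Σ[ (λ i → λs i * v (w i) k) ] ≡ 0#) → ∀ i → λs i ≡ 0#

  HasDim : VSet → ℕ → Set
  HasDim F k = (∃[ w ] ((∀ i → F (w i)) × AffIndep {k} w))
             × (∀ (w : Fin (suc (suc k)) → Fin n) → (∀ i → F (w i)) → ¬ AffIndep w)

  IsKFace : ℕ → VSet → Set
  IsKFace k F = IsFace F × HasDim F k

  IsVertexList : Set
  IsVertexList = ∀ i → IsFace (λ j → j ≡ i)

  Edge : Fin n → Fin n → Set
  Edge i j = i ≢ j × IsFace (λ k → k ≡ i ⊎ k ≡ j)

  whole : VSet
  whole _ = Fin n

  -- Orientations of the 1-skeleton.  Arc i j : the edge {i,j} is
  -- directed from i to j.

  module Oriented (Arc : Fin n → Fin n → Set) where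

    IsOrientation : Set
    IsOrientation = (∀ i j → Arc i j → Edge i j)
                  × (∀ i j → Edge i j → Arc i j ⊎ Arc j i)
                  × (∀ i j → Arc i j → ¬ Arc j i)

    Acyclic : Set
    Acyclic = ∀ i → ¬ TransClosure Arc i i

    -- source / sink of a face F (w.r.t. the edges of F, i.e. the edges
    -- of Q with both endpoints in F)
    IsSrc : VSet → Fin n → Set
    IsSrc F s = F s × (∀ y → F y → ¬ Arc y s)

    IsSink : VSet → Fin n → Set
    IsSink F t = F t × (∀ y → F y → ¬ Arc t y)

    IsFacialOrientation : Set₁
    IsFacialOrientation = IsOrientation × Acyclic
      × (∀ F → IsFace F →
           (∃[ s ] (IsSrc F s × ∀ s′ → IsSrc F s′ → s′ ≡ s))
         × (∃[ t ] (IsSink F t × ∀ t′ → IsSink F t′ → t′ ≡ t)))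

    -- Q is O-directionally simple: for each vertex x and each set E of
    -- out-neighbours of x there is a unique |E|-face containing x and
    -- the edges from x to E (uniqueness up to equality of vertex sets).
    DirectionallySimple : Set₁
    DirectionallySimple = ∀ x (E : List (Fin n)) → Unique E → All (Arc x) E →
      Σ VSet (λ G → (IsKFace (length E) G × G x × All G E)
        × (∀ G′ → IsKFace (length E) G′ → G′ x → All G′ E →
             ∀ i → (G i → G′ i) × (G′ i → G i)))

    module Lat (_≤L_ : Fin n → Fin n → Set) where

      _<L_ : Fin n → Fin n → Set
      a <L b = a ≤L b × a ≢ b

      Covers : Fin n → Fin n → Set
      Covers a b = a <L b × (∀ z → a ≤L z → z ≤L b → z ≡ a ⊎ z ≡ b)

      IsHasse : Set
      IsHasse = ∀ a b → (Arc a b → Covers a b) × (Covers a b → Arc a b)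

      -- saturated chains from u to v, as lists of vertices u … v with
      -- consecutive elements joined by arcs (= cover relations)
      data SatChain : Fin n → Fin n → List (Fin n) → Set where
        single : ∀ u → SatChain u u (u ∷ [])
        step   : ∀ {u w z c} → Arc u w → SatChain w z c → SatChain u z (u ∷ c)

      AgreeOn : List (Fin n) → List (Fin n) → Fin n → Fin n → Set
      AgreeOn c₁ c₂ a b = ∀ y → a ≤L y → y ≤L b → (y ∈ c₁ → y ∈ c₂) × (y ∈ c₂ → y ∈ c₁)

      DivergesAt : List (Fin n) → List (Fin n) → Fin n → Fin n → Fin n → Set
      DivergesAt γ₁ γ₂ y b₁ b₂ = y ∈ γ₁ × y ∈ γ₂ × b₁ ∈ γ₁ × b₂ ∈ γ₂
        × Arc y b₁ × Arc y b₂ × b₁ ≢ b₂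

      -- StarPath u z γ₁ γ₂ P : P is (the list of chains visited by) a
      -- path γ₁ * γ₂ in the move graph, for some admissible choices.
      data StarPath (u z : Fin n) : List (Fin n) → List (Fin n)
                                  → List (List (Fin n)) → Set₁ where
        trivial : ∀ {γ} → SatChain u z γ → StarPath u z γ γ (γ ∷ [])
        recurse : ∀ {γ₁ γ₂ P₁ P₂} (x a₁ a₂ x′ s : Fin n) (F : VSet)
          (p pt β₁ β₂ pre₁ pre₂ rest₁ rest₂ γ₁F γ₂F : List (Fin n)) →
          SatChain u z γ₁ → SatChain u z γ₂ → γ₁ ≢ γ₂ →
          -- x: lowest element of γ₁ ∩ γ₂ covered by distinct a₁ ∈ γ₁, a₂ ∈ γ₂
          DivergesAt γ₁ γ₂ x a₁ a₂ →
          (∀ y b₁ b₂ → DivergesAt γ₁ γ₂ y b₁ b₂ → x ≤L y) →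
          -- x′: next element of γ₁ ∩ γ₂ above x
          x′ ∈ γ₁ → x′ ∈ γ₂ → x <L x′ →
          (∀ y → y ∈ γ₁ → y ∈ γ₂ → x <L y → x′ ≤L y) →
          -- F: the 2-face containing the edges x a₁ and x a₂, s = sink F
          IsKFace 2 F → F x → F a₁ → F a₂ → IsSink F s →
          -- p: saturated chain from s to z through x′, agreeing with γ₁
          -- on [x′, z], and on [s, z] if s ∈ γ₁
          p ≡ s ∷ pt → SatChain s z p → x′ ∈ p → AgreeOn p γ₁ x′ z →
          (s ∈ γ₁ → AgreeOn p γ₁ s z) →
          -- βᵢ: the boundary path of F from aᵢ to s
          SatChain a₁ s β₁ → All F β₁ → SatChain a₂ s β₂ → All F β₂ →
          -- γᵢF = γᵢ from u to aᵢ, then βᵢ, then p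
          γ₁ ≡ pre₁ ++ a₁ ∷ rest₁ → γ₂ ≡ pre₂ ++ a₂ ∷ rest₂ →
          γ₁F ≡ pre₁ ++ β₁ ++ pt → γ₂F ≡ pre₂ ++ β₂ ++ pt →
          -- moves of γ₁ * γ₁F, the move across F, moves of γ₂F * γ₂
          StarPath u z γ₁ γ₁F P₁ → StarPath u z γ₂F γ₂ P₂ →
          StarPath u z γ₁ γ₂ (P₁ ++ P₂)

{-# OPTIONS --safe #-}
-- The claim holds for every x′ ∈ γ₁ ∩ γ₂ and is proved by induction on the
-- construction of γ₁ * γ₂, whose first divergence point we call x.  If
-- x′ ≤ x, then γ₁ and γ₂ already agree below x′, and the first chain of the
-- path, γ₁ itself, is the required one.  Otherwise x′ lies above the next
-- common element, hence above sink(F); the detours γ₁^F and γ₂^F differ from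
-- γ₁ only below sink(F), so they agree with γ₁ on [x′, 1̂].  A path between
-- two chains agreeing on [x′, 1̂] never touches that segment, so all of
-- γ₁ * γ₁^F fixes it, and the induction hypothesis for γ₂^F * γ₂ supplies
-- the required chain.
module Submission where

open import Defs
open import Data.Nat using (ℕ)
open import Data.Fin using (Fin)
open import Data.Fin.Properties using (_≟_)
open import Data.List using (List; []; _∷_; _++_)
open import Data.List.Properties using (++-assoc)
open import Data.List.Membership.Propositional using (_∈_)
open import Data.List.Membership.Propositional.Properties using (∈-++⁺ˡ; ∈-++⁺ʳ; ∈-++⁻)
open import Data.List.Relation.Unary.Any using (here; there)
open import Data.List.Relation.Unary.All as All using (All; []; _∷_)
open import Data.List.Relation.Unary.All.Properties using (++⁺)
open import Data.Product using (∃-syntax; _×_; _,_; proj₁; proj₂)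
open import Data.Sum using (_⊎_; inj₁; inj₂)
open import Data.Empty using (⊥-elim)
open import Function using (_∘_)
open import Relation.Nullary using (yes; no)
open import Relation.Binary.PropositionalEquality
  using (_≡_; _≢_; refl; sym; trans; cong; subst)
open import Relation.Binary.Lattice.Structures using (IsLattice)
open import Relation.Binary.Structures using (IsPartialOrder)

module _ (K : OrderedField) {d n : ℕ} (v : Fin n → Fin d → OrderedField.Carrier K)
         (Arc : Fin n → Fin n → Set) {_≤L_ : Fin n → Fin n → Set}
         (≤L-isPartialOrder : IsPartialOrder _≡_ _≤L_) where

  open Geometry K v
  open Oriented Arc
  open Lat _≤L_
  open IsPartialOrder ≤L-isPartialOrder
    using () renaming (refl to ≤L-refl; trans to ≤L-trans; antisym to ≤L-antisym)

  agreeOn-refl : ∀ {c a b} → AgreeOn c c a b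
  agreeOn-refl y _ _ = (λ m → m) , (λ m → m)

  agreeOn-sym : ∀ {c e a b} → AgreeOn c e a b → AgreeOn e c a b
  agreeOn-sym agree y a≤y y≤b = proj₂ (agree y a≤y y≤b) , proj₁ (agree y a≤y y≤b)

  agreeOn-trans : ∀ {c e f a b} → AgreeOn c e a b → AgreeOn e f a b → AgreeOn c f a b
  agreeOn-trans agree agree′ y a≤y y≤b =
    proj₁ (agree′ y a≤y y≤b) ∘ proj₁ (agree y a≤y y≤b) ,
    proj₂ (agree y a≤y y≤b) ∘ proj₂ (agree′ y a≤y y≤b)

  agreeOn-monoˡ : ∀ {c e a a′ b} → a ≤L a′ → AgreeOn c e a b → AgreeOn c e a′ b
  agreeOn-monoˡ a≤a′ agree y a′≤y = agree y (≤L-trans a≤a′ a′≤y)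

  agreeOn-bottom : ∀ {c e a b} → AgreeOn c e a b → a ≤L b → a ∈ c → a ∈ e
  agreeOn-bottom agree a≤b = proj₁ (agree _ ≤L-refl a≤b)

  TransformsBelowFirst : Fin n → Fin n → Fin n → List (Fin n) → List (Fin n) →
    List (List (Fin n)) → Set
  TransformsBelowFirst u y z γ₁ γ₂ P = ∃[ Q ] ∃[ c ] ∃[ R ] (P ≡ Q ++ c ∷ R
    × All (λ c′ → AgreeOn c′ γ₁ y z) Q
    × AgreeOn c γ₁ y z
    × AgreeOn c γ₂ u y)

  transformsBelowFirst-++ : ∀ {u y z γ γ₁ γ₂ P₁ P₂} → All (λ c → AgreeOn c γ₁ y z) P₁ →
    AgreeOn γ γ₁ y z → TransformsBelowFirst u y z γ γ₂ P₂ →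
    TransformsBelowFirst u y z γ₁ γ₂ (P₁ ++ P₂)
  transformsBelowFirst-++ {P₁ = P₁} P₁-agrees γ-agrees
    (Q , c , R , P₂≡ , Q-agrees , c-agrees , c-done) =
    P₁ ++ Q , c , R , trans (cong (P₁ ++_) P₂≡) (sym (++-assoc P₁ Q (c ∷ R))) ,
    ++⁺ P₁-agrees (All.map (λ c′-agrees → agreeOn-trans c′-agrees γ-agrees) Q-agrees) ,
    agreeOn-trans c-agrees γ-agrees , c-done

  agreeOn-replace-bottom : ∀ {front s pt γ y b} → (∀ {w} → w ∈ front → w ≤L s) →
    s ∈ front → s ≤L y → y ∈ γ → AgreeOn (s ∷ pt) γ y b → AgreeOn (front ++ pt) γ y b
  agreeOn-replace-bottom {front} {pt = pt} {γ} front≤s s∈front s≤y y∈γ agree w y≤w w≤b =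
    to , from
    where
    to : w ∈ front ++ pt → w ∈ γ
    to w∈ with ∈-++⁻ front w∈
    ... | inj₁ w∈front = subst (_∈ γ) (≤L-antisym y≤w (≤L-trans (front≤s w∈front) s≤y)) y∈γ
    ... | inj₂ w∈pt    = proj₁ (agree w y≤w w≤b) (there w∈pt)

    from : w ∈ γ → w ∈ front ++ pt
    from w∈γ with proj₂ (agree w y≤w w≤b) w∈γ
    ... | here refl  = ∈-++⁺ˡ s∈front
    ... | there w∈pt = ∈-++⁺ʳ front w∈pt

  module _ (arc⇒covers : ∀ {a b} → Arc a b → Covers a b) where

    arc⇒≤L : ∀ {a b} → Arc a b → a ≤L b
    arc⇒≤L = proj₁ ∘ proj₁ ∘ arc⇒covers

    arc⇒≢ : ∀ {a b} → Arc a b → a ≢ b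
    arc⇒≢ = proj₂ ∘ proj₁ ∘ arc⇒covers

    head∈ : ∀ {u z c} → SatChain u z c → u ∈ c
    head∈ (single _) = here refl
    head∈ (step _ _) = here refl

    last∈ : ∀ {u z c} → SatChain u z c → z ∈ c
    last∈ (single _)    = here refl
    last∈ (step _ rest) = there (last∈ rest)

    head-≤ : ∀ {u z c y} → SatChain u z c → y ∈ c → u ≤L y
    head-≤ (single _)     (here refl) = ≤L-refl
    head-≤ (step _ _)     (here refl) = ≤L-refl
    head-≤ (step ar rest) (there y∈)  = ≤L-trans (arc⇒≤L ar) (head-≤ rest y∈)

    ≤-last : ∀ {u z c y} → SatChain u z c → y ∈ c → y ≤L z
    ≤-last (single _)     (here refl) = ≤L-refl
    ≤-last (step ar rest) (here refl) = ≤L-trans (arc⇒≤L ar) (≤-last rest (head∈ rest))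
    ≤-last (step _ rest)  (there y∈)  = ≤-last rest y∈

    chain-total : ∀ {u z c a b} → SatChain u z c → a ∈ c → b ∈ c → a ≤L b ⊎ b ≤L a
    chain-total ch@(single _) (here refl) b∈          = inj₁ (head-≤ ch b∈)
    chain-total ch@(step _ _) (here refl) b∈          = inj₁ (head-≤ ch b∈)
    chain-total ch@(step _ _) a∈          (here refl) = inj₂ (head-≤ ch a∈)
    chain-total (step _ rest) (there a∈)  (there b∈)  = chain-total rest a∈ b∈

    chain-≤⊎> : ∀ {u z c a b} → SatChain u z c → a ∈ c → b ∈ c → a ≤L b ⊎ b <L a
    chain-≤⊎> {a = a} {b} ch a∈ b∈ with chain-total ch a∈ b∈ | a ≟ b
    ... | inj₁ a≤b | _        = inj₁ a≤b
    ... | inj₂ b≤a | yes refl = inj₁ b≤a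
    ... | inj₂ b≤a | no a≢b   = inj₂ (b≤a , a≢b ∘ sym)

    head-≤-tail : ∀ {u z h c y} → SatChain u z (h ∷ c) → y ∈ c → h ≤L y
    head-≤-tail ch@(step _ _) y∈ = head-≤ ch (there y∈)

    chain-++-≤ : ∀ xs {u z ys y w} → SatChain u z (xs ++ ys) → y ∈ xs → w ∈ ys → y ≤L w
    chain-++-≤ (_ ∷ xs)         ch            (here refl) w∈ = head-≤-tail ch (∈-++⁺ʳ xs w∈)
    chain-++-≤ (_ ∷ xs@(_ ∷ _)) (step _ rest) (there y∈)  w∈ = chain-++-≤ xs rest y∈ w∈

    chain-covers-unique : ∀ {u z c x a b} → SatChain u z c → a ∈ c → b ∈ c →
      Arc x a → Arc x b → a ≡ b
    chain-covers-unique ch a∈ b∈ x⋖a x⋖b with chain-total ch a∈ b∈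
    ... | inj₁ a≤b with proj₂ (arc⇒covers x⋖b) _ (arc⇒≤L x⋖a) a≤b
    ...   | inj₁ a≡x = ⊥-elim (arc⇒≢ x⋖a (sym a≡x))
    ...   | inj₂ a≡b = a≡b
    chain-covers-unique ch a∈ b∈ x⋖a x⋖b | inj₂ b≤a
      with proj₂ (arc⇒covers x⋖a) _ (arc⇒≤L x⋖b) b≤a
    ...   | inj₁ b≡x = ⊥-elim (arc⇒≢ x⋖b (sym b≡x))
    ...   | inj₂ b≡a = sym b≡a

    BelowDivergences : Fin n → List (Fin n) → List (Fin n) → Set
    BelowDivergences x₀ γ₁ γ₂ = ∀ y b₁ b₂ → DivergesAt γ₁ γ₂ y b₁ b₂ → x₀ ≤L y

    belowDivergences-swap : ∀ {x₀ γ₁ γ₂} →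
      BelowDivergences x₀ γ₁ γ₂ → BelowDivergences x₀ γ₂ γ₁
    belowDivergences-swap below y b₂ b₁ (y∈₂ , y∈₁ , b₂∈ , b₁∈ , y⋖b₂ , y⋖b₁ , b₂≢b₁) =
      below y b₁ b₂ (y∈₁ , y∈₂ , b₁∈ , b₂∈ , y⋖b₁ , y⋖b₂ , b₂≢b₁ ∘ sym)

    belowDivergences-tail : ∀ {x₀ w₁ w₂ γ₁ γ₂} →
      BelowDivergences x₀ (w₁ ∷ γ₁) (w₂ ∷ γ₂) → BelowDivergences x₀ γ₁ γ₂
    belowDivergences-tail below y b₁ b₂ (y∈₁ , y∈₂ , b₁∈ , b₂∈ , rest) =
      below y b₁ b₂ (there y∈₁ , there y∈₂ , there b₁∈ , there b₂∈ , rest)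

    belowDivergences-⊆ : ∀ {u z γ₁ γ₂ x₀ y} → SatChain u z γ₁ → SatChain u z γ₂ →
      BelowDivergences x₀ γ₁ γ₂ → y ≤L x₀ → y ∈ γ₁ → y ∈ γ₂
    belowDivergences-⊆ (single _) ch₂ _ _ (here refl) = head∈ ch₂
    belowDivergences-⊆ (step _ _) ch₂ _ _ (here refl) = head∈ ch₂
    belowDivergences-⊆ (step ar rest) (single _) _ _ (there y∈) =
      subst (_∈ _) (≤L-antisym (head-≤ (step ar rest) (there y∈)) (≤-last rest y∈)) (here refl)
    belowDivergences-⊆ (step {w = w₁} ar₁ rest₁) (step {w = w₂} ar₂ rest₂) below y≤x₀ (there y∈)
      with w₁ ≟ w₂
    ... | yes refl =
      there (belowDivergences-⊆ rest₁ rest₂ (belowDivergences-tail below) y≤x₀ y∈)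
    ... | no w₁≢w₂ =
      subst (_∈ _) (≤L-antisym (head-≤ (step ar₁ rest₁) (there y∈)) (≤L-trans y≤x₀ x₀≤u))
        (here refl)
      where
      x₀≤u = below _ w₁ w₂ (here refl , here refl , there (head∈ rest₁) , there (head∈ rest₂) ,
                            ar₁ , ar₂ , w₁≢w₂)

    agreeOn-belowDivergences : ∀ {u z γ₁ γ₂ x₀ a y} → SatChain u z γ₁ → SatChain u z γ₂ →
      BelowDivergences x₀ γ₁ γ₂ → y ≤L x₀ → AgreeOn γ₁ γ₂ a y
    agreeOn-belowDivergences ch₁ ch₂ below y≤x₀ w _ w≤y =
      belowDivergences-⊆ ch₁ ch₂ below w≤x₀ ,
      belowDivergences-⊆ ch₂ ch₁ (belowDivergences-swap below) w≤x₀
      where w≤x₀ = ≤L-trans w≤y y≤x₀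

    -- γ^F = pre ++ β ++ pt is γ = pre ++ a ∷ rest rerouted along β from a to
    -- s and then along p = s ∷ pt; everything in pre ++ β lies below s.
    detour-agreeOn-above : ∀ pre {u z a rest s β pt b x₀′ y γ} →
      SatChain u z (pre ++ a ∷ rest) → SatChain a s β → SatChain s b (s ∷ pt) →
      x₀′ ∈ s ∷ pt → AgreeOn (s ∷ pt) γ x₀′ b → x₀′ ≤L y → y ∈ γ →
      AgreeOn (pre ++ β ++ pt) γ y b
    detour-agreeOn-above pre {s = s} {β} {pt} {b} {y = y} {γ} ch chβ chp x₀′∈p p-agrees x₀′≤y y∈γ =
      subst (λ c → AgreeOn c γ y b) (++-assoc pre β pt)
        (agreeOn-replace-bottom front≤s (∈-++⁺ʳ pre (last∈ chβ))
          (≤L-trans (head-≤ chp x₀′∈p) x₀′≤y) y∈γ (agreeOn-monoˡ x₀′≤y p-agrees))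
      where
      front≤s : ∀ {w} → w ∈ pre ++ β → w ≤L s
      front≤s w∈ with ∈-++⁻ pre w∈
      ... | inj₁ w∈pre = ≤L-trans (chain-++-≤ pre ch w∈pre (here refl)) (head-≤ chβ (last∈ chβ))
      ... | inj₂ w∈β   = ≤-last chβ w∈β

    starPath-head : ∀ {u z γ₁ γ₂ P} → StarPath u z γ₁ γ₂ P → ∃[ R ] (P ≡ γ₁ ∷ R)
    starPath-head (trivial _) = _ , refl
    starPath-head (recurse {P₂ = P₂} _ _ _ _ _ _ _ _ _ _ _ _ _ _ _ _ _ _ _ _ _ _ _ _ _
                     _ _ _ _ _ _ _ _ _ _ _ _ _ _ _ _ _ _ sp₁ _)
      with starPath-head sp₁
    ... | R , P₁≡ = R ++ P₂ , cong (_++ P₂) P₁≡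

    starPath-fixes-agreeOn : ∀ {u z γ₁ γ₂ P y} → StarPath u z γ₁ γ₂ P → y ∈ γ₁ →
      AgreeOn γ₁ γ₂ y z → All (λ c → AgreeOn c γ₁ y z) P
    starPath-fixes-agreeOn (trivial _) _ _ = agreeOn-refl ∷ []
    starPath-fixes-agreeOn {y = y}
      (recurse _ _ _ _ _ _ _ _ _ _ pre₁ pre₂ _ _ _ _ ch₁ ch₂ _
               (x∈₁ , _ , a₁∈₁ , a₂∈₂ , x⋖a₁ , x⋖a₂ , a₁≢a₂) _ _ _ _ next
               _ _ _ _ _ refl chp x₀′∈p p-agrees _ chβ₁ _ chβ₂ _ refl refl refl refl sp₁ sp₂)
      y∈₁ agree₁₂ with chain-≤⊎> ch₁ y∈₁ x∈₁
    ... | inj₁ y≤x = ⊥-elim (a₁≢a₂ (chain-covers-unique ch₂ a₁∈₂ a₂∈₂ x⋖a₁ x⋖a₂))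
      where
      a₁∈₂ = proj₁ (agree₁₂ _ (≤L-trans y≤x (arc⇒≤L x⋖a₁)) (≤-last ch₁ a₁∈₁)) a₁∈₁
    ... | inj₂ x<y =
      ++⁺ (starPath-fixes-agreeOn sp₁ y∈₁ (agreeOn-sym γ₁F-agrees))
          (All.map (λ c-agrees → agreeOn-trans c-agrees γ₂F-agrees)
            (starPath-fixes-agreeOn sp₂ y∈γ₂F (agreeOn-trans γ₂F-agrees agree₁₂)))
      where
      y≤z = ≤-last ch₁ y∈₁
      x₀′≤y = next y y∈₁ (agreeOn-bottom agree₁₂ y≤z y∈₁) x<y
      γ₁F-agrees = detour-agreeOn-above pre₁ ch₁ chβ₁ chp x₀′∈p p-agrees x₀′≤y y∈₁
      γ₂F-agrees = detour-agreeOn-above pre₂ ch₂ chβ₂ chp x₀′∈p p-agrees x₀′≤y y∈₁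
      y∈γ₂F = agreeOn-bottom (agreeOn-sym γ₂F-agrees) y≤z y∈₁

    starPath-transforms-below-first : ∀ {u z γ₁ γ₂ P y} → StarPath u z γ₁ γ₂ P →
      y ∈ γ₁ → y ∈ γ₂ → TransformsBelowFirst u y z γ₁ γ₂ P
    starPath-transforms-below-first (trivial _) _ _ =
      [] , _ , [] , refl , [] , agreeOn-refl , agreeOn-refl
    starPath-transforms-below-first {y = y}
      sp@(recurse _ _ _ _ _ _ _ _ _ _ pre₁ pre₂ _ _ _ _ ch₁ ch₂ _ (x∈₁ , _) lowest _ _ _ next
                  _ _ _ _ _ refl chp x₀′∈p p-agrees _ chβ₁ _ chβ₂ _ refl refl refl refl sp₁ sp₂)
      y∈₁ y∈₂ with chain-≤⊎> ch₁ y∈₁ x∈₁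
    ... | inj₁ y≤x =
      let R , P≡ = starPath-head sp
      in [] , _ , R , P≡ , [] , agreeOn-refl , agreeOn-belowDivergences ch₁ ch₂ lowest y≤x
    ... | inj₂ x<y =
      transformsBelowFirst-++
        (starPath-fixes-agreeOn sp₁ y∈₁ (agreeOn-sym γ₁F-agrees)) γ₂F-agrees
        (starPath-transforms-below-first sp₂ y∈γ₂F y∈₂)
      where
      x₀′≤y = next y y∈₁ y∈₂ x<y
      γ₁F-agrees = detour-agreeOn-above pre₁ ch₁ chβ₁ chp x₀′∈p p-agrees x₀′≤y y∈₁
      γ₂F-agrees = detour-agreeOn-above pre₂ ch₂ chβ₂ chp x₀′∈p p-agrees x₀′≤y y∈₁
      y∈γ₂F = agreeOn-bottom (agreeOn-sym γ₂F-agrees) (≤-last ch₁ y∈₁) y∈₁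

lemma4p3 : (K : OrderedField) (d n : ℕ) (v : Fin n → Fin d → OrderedField.Carrier K)
    (Arc : Fin n → Fin n → Set) (_≤L_ : Fin n → Fin n → Set)
    (_∨_ _∧_ : Fin n → Fin n → Fin n) →
    let open Geometry K v
        open Oriented Arc
        open Lat _≤L_
    in IsVertexList → IsFacialOrientation → DirectionallySimple →
       IsLattice _≡_ _≤L_ _∨_ _∧_ → IsHasse →
       ∀ (bot top : Fin n) → IsSrc whole bot → IsSink whole top →
       ∀ (γ₁ γ₂ : List (Fin n)) → SatChain bot top γ₁ → SatChain bot top γ₂ →
       ∀ (x x′ a₁ a₂ : Fin n) → x <L x′ → x′ ∈ γ₁ → x′ ∈ γ₂ →
       DivergesAt γ₁ γ₂ x a₁ a₂ →
       ∀ (P : List (List (Fin n))) → StarPath bot top γ₁ γ₂ P →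
       ∃[ Q ] ∃[ c ] ∃[ R ] (P ≡ Q ++ c ∷ R
         × All (λ c′ → AgreeOn c′ γ₁ x′ top) Q
         × AgreeOn c γ₁ x′ top
         × AgreeOn c γ₂ bot x′)
lemma4p3 K d n v Arc _≤L_ _∨_ _∧_ _ _ _ isLattice isHasse _ _ _ _ _ _ _ _ _ _ _ _ _ x′∈₁ x′∈₂ _ _ sp =
  starPath-transforms-below-first K v Arc (IsLattice.isPartialOrder isLattice)
    (λ {a} {b} → proj₁ (isHasse a b)) sp x′∈₁ x′∈₂
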